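{- For every integer $n\geq 0$, \[ x(x+1)Q_{n}''(x)+(2x-n)Q_{n}'(x)-n(n+1)Q_{n}(x)=0. \]
   Context: For each integer $n\geq 0$, $P_n(x),Q_n(x)\in\mathbb{Q}[x]$ denote the unique pair of polynomials with $\deg P_n\leq n$, $\deg Q_n\leq n$ satisfying $P_n(x)x^{n+1}+Q_n(x)(x+1)^{n+1}=1$. -}

module Defs where

open import Data.Nat using (ℕ; zero; suc)
open import Data.List using (List; []; _∷_; length)
open import Data.Rational using (ℚ; 0ℚ; 1ℚ; _+_; _*_; _-_)
import Data.Rational as ℚ
import Data.Integer
open import Relation.Binary.PropositionalEquality using (_≡_)

-- Polynomials in ℚ[x] as coefficient lists, lowest degree first:
-- a₀ ∷ a₁ ∷ … represents a₀ + a₁ x + … .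
Poly : Set
Poly = List ℚ

coeff : Poly → ℕ → ℚ
coeff []       _       = 0ℚ
coeff (a ∷ p)  zero    = a
coeff (a ∷ p)  (suc k) = coeff p k

infix 4 _≈ₚ_
_≈ₚ_ : Poly → Poly → Set
p ≈ₚ q = ∀ k → coeff p k ≡ coeff q k

deg≤ : Poly → ℕ → Set
deg≤ p n = ∀ k → n Data.Nat.< k → coeff p k ≡ 0ℚ

infixl 6 _+ₚ_
_+ₚ_ : Poly → Poly → Poly
[]      +ₚ q       = q
(a ∷ p) +ₚ []      = a ∷ p
(a ∷ p) +ₚ (b ∷ q) = (a + b) ∷ (p +ₚ q)

infixl 7 _·ₚ_
_·ₚ_ : ℚ → Poly → Poly
c ·ₚ []      = []
c ·ₚ (a ∷ p) = (c * a) ∷ (c ·ₚ p)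

infixl 7 _*ₚ_
_*ₚ_ : Poly → Poly → Poly
[]      *ₚ q = []
(a ∷ p) *ₚ q = (a ·ₚ q) +ₚ (0ℚ ∷ (p *ₚ q))

constₚ : ℚ → Poly
constₚ c = c ∷ []

X : Poly
X = 0ℚ ∷ 1ℚ ∷ []

infixr 8 _^ₚ_
_^ₚ_ : Poly → ℕ → Poly
p ^ₚ zero  = constₚ 1ℚ
p ^ₚ suc k = p *ₚ (p ^ₚ k)

ℕ→ℚ : ℕ → ℚ
ℕ→ℚ k = (Data.Integer.+ k) ℚ./ 1

derivAux : ℕ → Poly → Poly
derivAux i []      = []
derivAux i (a ∷ p) = (ℕ→ℚ i * a) ∷ derivAux (suc i) p

deriv : Poly → Poly
deriv []      = []
deriv (a ∷ p) = derivAux 1 p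

module Submission where

-- Let q be the coefficient sequence of Q and put
--     R = (x+1) Q' + (n+1) Q .
-- A direct coefficient computation shows that the differential expression
-- of the theorem equals  x R' - n R,  whose k-th coefficient is (k - n) R_k.
-- So it suffices to show that R_k = 0 for every k ≠ n.
--   * For k > n this holds because deg Q ≤ n.
--   * For k < n: the Bézout identity says that Q (1+x)^(n+1) ≡ 1 modulo
--     x^(n+1), so the derivative of Q (1+x)^(n+1), which is (1+x)^n R,
--     vanishes modulo x^n; since 1+x is invertible modulo x^n, so does R.

open import Defs
open import Data.Nat using (ℕ; suc)
open import Data.Rational using (ℚ; 0ℚ; 1ℚ; -_)
import Data.Nat as ℕ

open import Data.Nat using (zero; _<_; s≤s)
open import Data.List using ([]; _∷_)
import Data.Integer as ℤ
open import Data.Integer.Properties using (+◃n≡+n)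
import Data.Nat.Coprimality as Coprime
import Data.Nat.Properties as ℕₚ
open ℕₚ using (<-cmp; <-trans; n<1+n)
open import Data.Rational using (mkℚ; _+_; _*_; _-_)
open import Data.Rational.Properties
  using (normalize-coprime; +-identityˡ; +-identityʳ; *-identityˡ; *-zeroˡ; *-zeroʳ; +-inverseʳ)
open import Data.Rational.Solver using (module +-*-Solver)
open +-*-Solver using (solve; _:=_; _:+_; _:*_; :-_; _:-_; con)
open import Relation.Binary.Definitions using (tri<; tri≈; tri>)
open import Relation.Binary.PropositionalEquality
open ≡-Reasoning

-- ℕ→ℚ m is already the reduced fraction m/1, so ℕ→ℚ commutes with
-- successor and multiplication by computation.

ℕ→ℚ-mkℚ : ∀ m → ℕ→ℚ m ≡ mkℚ (ℤ.+ m) 0 (Coprime.sym (Coprime.1-coprimeTo m))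
ℕ→ℚ-mkℚ m = normalize-coprime (Coprime.sym (Coprime.1-coprimeTo m))

ℕ→ℚ-suc : ∀ m → ℕ→ℚ (suc m) ≡ 1ℚ + ℕ→ℚ m
ℕ→ℚ-suc m rewrite ℕ→ℚ-mkℚ m | ℕₚ.*-identityʳ m | +◃n≡+n m = refl

ℕ→ℚ-* : ∀ m k → ℕ→ℚ (m ℕ.* k) ≡ ℕ→ℚ m * ℕ→ℚ k
ℕ→ℚ-* m k rewrite ℕ→ℚ-mkℚ m | ℕ→ℚ-mkℚ k | +◃n≡+n (m ℕ.* k) = refl

Seq : Set
Seq = ℕ → ℚ

-- u is divisible by x^K: its first K coefficients vanish.
VanishBelow : ℕ → Seq → Set
VanishBelow K u = ∀ k → k < K → u k ≡ 0ℚ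

shift : Seq → Seq
shift u zero    = 0ℚ
shift u (suc k) = u k

-- multiplication by 1 + x, and by (1 + x)^m
T : Seq → Seq
T u k = u k + shift u k

Tⁿ : ℕ → Seq → Seq
Tⁿ zero    u = u
Tⁿ (suc m) u = T (Tⁿ m u)

∂ : Seq → Seq
∂ u k = ℕ→ℚ (suc k) * u (suc k)

R : ℕ → Seq → Seq
R m u k = T (∂ u) k + ℕ→ℚ (suc m) * u k

shift-cong : ∀ {u v} → u ≗ v → shift u ≗ shift v
shift-cong u≗v zero    = refl
shift-cong u≗v (suc k) = u≗v k

T-cong : ∀ {u v} → u ≗ v → T u ≗ T v
T-cong u≗v k = cong₂ _+_ (u≗v k) (shift-cong u≗v k)

Tⁿ-cong : ∀ m {u v} → u ≗ v → Tⁿ m u ≗ Tⁿ m v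
Tⁿ-cong zero    u≗v = u≗v
Tⁿ-cong (suc m) u≗v = T-cong (Tⁿ-cong m u≗v)

shift-+ : ∀ (u v : Seq) k → shift (λ i → u i + v i) k ≡ shift u k + shift v k
shift-+ u v zero    = refl
shift-+ u v (suc k) = refl

shift-scale : ∀ c (u : Seq) k → shift (λ i → c * u i) k ≡ c * shift u k
shift-scale c u zero    = sym (*-zeroʳ c)
shift-scale c u (suc k) = refl

shift-linear : ∀ a b (u v : Seq) k →
  shift (λ i → a * u i + b * v i) k ≡ a * shift u k + b * shift v k
shift-linear a b u v k = trans (shift-+ _ _ k) (cong₂ _+_ (shift-scale a u k) (shift-scale b v k))

shift-vanish : ∀ {K u} → VanishBelow K u → VanishBelow (suc K) (shift u)
shift-vanish u-vanish zero    _         = refl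
shift-vanish u-vanish (suc k) (s≤s k<K) = u-vanish k k<K

Tⁿ-+ : ∀ m (u v : Seq) → Tⁿ m (λ i → u i + v i) ≗ λ k → Tⁿ m u k + Tⁿ m v k
Tⁿ-+ zero    u v k = refl
Tⁿ-+ (suc m) u v k = begin
  T (Tⁿ m (λ i → u i + v i)) k             ≡⟨ T-cong (Tⁿ-+ m u v) k ⟩
  T (λ i → Tⁿ m u i + Tⁿ m v i) k          ≡⟨ cong ((Tⁿ m u k + Tⁿ m v k) +_) (shift-+ (Tⁿ m u) (Tⁿ m v) k) ⟩
  (a + b) + (sa + sb)                      ≡⟨ solve 4 (λ a b sa sb → (a :+ b) :+ (sa :+ sb) := (a :+ sa) :+ (b :+ sb)) refl a b sa sb ⟩
  T (Tⁿ m u) k + T (Tⁿ m v) k              ∎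
  where
  a = Tⁿ m u k
  b = Tⁿ m v k
  sa = shift (Tⁿ m u) k
  sb = shift (Tⁿ m v) k

shift-∂ : ∀ (u : Seq) k → shift (∂ u) k ≡ ℕ→ℚ k * u k
shift-∂ u zero    = sym (*-zeroˡ (u 0))
shift-∂ u (suc k) = refl

shift²-∂² : ∀ (u : Seq) k → shift (shift (∂ (∂ u))) k ≡ (ℕ→ℚ k - 1ℚ) * ℕ→ℚ k * u k
shift²-∂² u k = trans (shift-cong (shift-∂ (∂ u)) k) (falling k)
  where
  falling : ∀ k → shift (λ i → ℕ→ℚ i * ∂ u i) k ≡ (ℕ→ℚ k - 1ℚ) * ℕ→ℚ k * u k
  falling zero    = solve 1 (λ a → con 0ℚ := (con 0ℚ :- con 1ℚ) :* con 0ℚ :* a) refl (u 0)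
  falling (suc k) rewrite ℕ→ℚ-suc k =
    solve 2 (λ κ a → κ :* ((con 1ℚ :+ κ) :* a) := ((con 1ℚ :+ κ) :- con 1ℚ) :* (con 1ℚ :+ κ) :* a)
      refl (ℕ→ℚ k) (u (suc k))

∂-T : ∀ (u : Seq) k → ∂ (T u) k ≡ T (∂ u) k + u k
∂-T u k = begin
  ℕ→ℚ (suc k) * (u (suc k) + u k)                       ≡⟨ expand ⟩
  (ℕ→ℚ (suc k) * u (suc k) + ℕ→ℚ k * u k) + u k         ≡⟨ cong (λ z → (∂ u k + z) + u k) (sym (shift-∂ u k)) ⟩
  T (∂ u) k + u k                                       ∎
  where
  expand : ℕ→ℚ (suc k) * (u (suc k) + u k) ≡ (ℕ→ℚ (suc k) * u (suc k) + ℕ→ℚ k * u k) + u k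
  expand rewrite ℕ→ℚ-suc k =
    solve 3 (λ κ a b → (con 1ℚ :+ κ) :* (b :+ a) := ((con 1ℚ :+ κ) :* b :+ κ :* a) :+ a)
      refl (ℕ→ℚ k) (u k) (u (suc k))

R-suc : ∀ m (u : Seq) k → R (suc m) u k ≡ R m u k + u k
R-suc m u k rewrite ℕ→ℚ-suc (suc m) =
  solve 3 (λ t c a → t :+ (con 1ℚ :+ c) :* a := (t :+ c :* a) :+ a) refl (T (∂ u) k) (ℕ→ℚ (suc m)) (u k)

∂-Tⁿ : ∀ m (u : Seq) → ∂ (Tⁿ (suc m) u) ≗ Tⁿ m (R m u)
∂-Tⁿ zero    u k = trans (∂-T u k) (cong (T (∂ u) k +_) (sym (*-identityˡ (u k))))
∂-Tⁿ (suc m) u k = begin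
  ∂ (T (Tⁿ (suc m) u)) k                           ≡⟨ ∂-T (Tⁿ (suc m) u) k ⟩
  T (∂ (Tⁿ (suc m) u)) k + Tⁿ (suc m) u k          ≡⟨ cong (_+ Tⁿ (suc m) u k) (T-cong (∂-Tⁿ m u) k) ⟩
  Tⁿ (suc m) (R m u) k + Tⁿ (suc m) u k            ≡⟨ Tⁿ-+ (suc m) (R m u) u k ⟨
  Tⁿ (suc m) (λ i → R m u i + u i) k               ≡⟨ Tⁿ-cong (suc m) (λ i → sym (R-suc m u i)) k ⟩
  Tⁿ (suc m) (R (suc m) u) k                       ∎

T-cancel : ∀ K (v : Seq) → VanishBelow K (T v) → VanishBelow K v
T-cancel K v Tv-vanish zero    0<K = trans (sym (+-identityʳ (v 0))) (Tv-vanish 0 0<K)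
T-cancel K v Tv-vanish (suc k) k<K = begin
  v (suc k)          ≡⟨ +-identityʳ (v (suc k)) ⟨
  v (suc k) + 0ℚ     ≡⟨ cong (v (suc k) +_) (T-cancel K v Tv-vanish k (<-trans (n<1+n k) k<K)) ⟨
  T v (suc k)        ≡⟨ Tv-vanish (suc k) k<K ⟩
  0ℚ                 ∎

Tⁿ-cancel : ∀ m K (v : Seq) → VanishBelow K (Tⁿ m v) → VanishBelow K v
Tⁿ-cancel zero    K v = λ vanish → vanish
Tⁿ-cancel (suc m) K v = λ vanish → Tⁿ-cancel m K v (T-cancel K (Tⁿ m v) vanish)

R-expand : ∀ m (u : Seq) k → R m u k ≡ (ℕ→ℚ (suc k) * u (suc k) + ℕ→ℚ k * u k) + ℕ→ℚ (suc m) * u k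
R-expand m u k = cong (λ z → (∂ u k + z) + ℕ→ℚ (suc m) * u k) (shift-∂ u k)

R-vanish-at : ∀ m (u : Seq) k → u k ≡ 0ℚ → u (suc k) ≡ 0ℚ → R m u k ≡ 0ℚ
R-vanish-at m u k uk≡0 usk≡0 = begin
  R m u k                                                       ≡⟨ R-expand m u k ⟩
  (ℕ→ℚ (suc k) * u (suc k) + ℕ→ℚ k * u k) + ℕ→ℚ (suc m) * u k  ≡⟨ cong₂ (λ a b → (ℕ→ℚ (suc k) * b + ℕ→ℚ k * a) + ℕ→ℚ (suc m) * a) uk≡0 usk≡0 ⟩
  (ℕ→ℚ (suc k) * 0ℚ + ℕ→ℚ k * 0ℚ) + ℕ→ℚ (suc m) * 0ℚ          ≡⟨ solve 3 (λ a b c → (a :* con 0ℚ :+ b :* con 0ℚ) :+ c :* con 0ℚ := con 0ℚ) refl (ℕ→ℚ (suc k)) (ℕ→ℚ k) (ℕ→ℚ (suc m)) ⟩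
  0ℚ                                                            ∎

euler-kernel : ∀ n (r : Seq) → VanishBelow n r → (∀ k → n < k → r k ≡ 0ℚ) →
               ∀ k → (ℕ→ℚ k - ℕ→ℚ n) * r k ≡ 0ℚ
euler-kernel n r below above k with <-cmp k n
... | tri< k<n _ _    = trans (cong ((ℕ→ℚ k - ℕ→ℚ n) *_) (below k k<n)) (*-zeroʳ (ℕ→ℚ k - ℕ→ℚ n))
... | tri≈ _ refl _   = trans (cong (_* r k) (+-inverseʳ (ℕ→ℚ n))) (*-zeroˡ (r k))
... | tri> _ _ n<k    = trans (cong ((ℕ→ℚ k - ℕ→ℚ n) *_) (above k n<k)) (*-zeroʳ (ℕ→ℚ k - ℕ→ℚ n))

coeff-+ₚ : ∀ p q k → coeff (p +ₚ q) k ≡ coeff p k + coeff q k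
coeff-+ₚ []      q       k       = sym (+-identityˡ (coeff q k))
coeff-+ₚ (a ∷ p) []      zero    = sym (+-identityʳ a)
coeff-+ₚ (a ∷ p) []      (suc k) = sym (+-identityʳ (coeff p k))
coeff-+ₚ (a ∷ p) (b ∷ q) zero    = refl
coeff-+ₚ (a ∷ p) (b ∷ q) (suc k) = coeff-+ₚ p q k

coeff-·ₚ : ∀ c p k → coeff (c ·ₚ p) k ≡ c * coeff p k
coeff-·ₚ c []      k       = sym (*-zeroʳ c)
coeff-·ₚ c (a ∷ p) zero    = refl
coeff-·ₚ c (a ∷ p) (suc k) = coeff-·ₚ c p k

coeff-zero : ∀ k → coeff (constₚ 0ℚ) k ≡ 0ℚ
coeff-zero zero    = refl
coeff-zero (suc k) = refl

coeff-∷*ₚ : ∀ a p q k → coeff ((a ∷ p) *ₚ q) k ≡ a * coeff q k + shift (coeff (p *ₚ q)) k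
coeff-∷*ₚ a p q k = trans (coeff-+ₚ (a ·ₚ q) (0ℚ ∷ (p *ₚ q)) k) (cong₂ _+_ (coeff-·ₚ a q k) (shifted k))
  where
  shifted : ∀ k → coeff (0ℚ ∷ (p *ₚ q)) k ≡ shift (coeff (p *ₚ q)) k
  shifted zero    = refl
  shifted (suc k) = refl

coeff-const*ₚ : ∀ c q k → coeff ((c ∷ []) *ₚ q) k ≡ c * coeff q k
coeff-const*ₚ c q k = trans (coeff-∷*ₚ c [] q k) (trans (cong (c * coeff q k +_) (nil k)) (+-identityʳ _))
  where
  nil : ∀ k → shift (coeff []) k ≡ 0ℚ
  nil zero    = refl
  nil (suc k) = refl

coeff-linear*ₚ : ∀ a b q k → coeff ((a ∷ b ∷ []) *ₚ q) k ≡ a * coeff q k + b * shift (coeff q) k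
coeff-linear*ₚ a b q k =
  trans (coeff-∷*ₚ a (b ∷ []) q k)
        (cong (a * coeff q k +_) (trans (shift-cong (coeff-const*ₚ b q) k) (shift-scale b (coeff q) k)))

coeff-quadratic*ₚ : ∀ a b c q k →
  coeff ((a ∷ b ∷ c ∷ []) *ₚ q) k ≡ a * coeff q k + (b * shift (coeff q) k + c * shift (shift (coeff q)) k)
coeff-quadratic*ₚ a b c q k = begin
  coeff ((a ∷ b ∷ c ∷ []) *ₚ q) k
    ≡⟨ coeff-∷*ₚ a (b ∷ c ∷ []) q k ⟩
  a * coeff q k + shift (coeff ((b ∷ c ∷ []) *ₚ q)) k
    ≡⟨ cong (a * coeff q k +_) (shift-cong (coeff-linear*ₚ b c q) k) ⟩
  a * coeff q k + shift (λ i → b * coeff q i + c * shift (coeff q) i) k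
    ≡⟨ cong (a * coeff q k +_) (shift-linear b c (coeff q) (shift (coeff q)) k) ⟩
  a * coeff q k + (b * shift (coeff q) k + c * shift (shift (coeff q)) k) ∎

coeff-*ₚ-one : ∀ p → coeff (p *ₚ constₚ 1ℚ) ≗ coeff p
coeff-*ₚ-one []      k       = refl
coeff-*ₚ-one (a ∷ p) zero    = trans (coeff-∷*ₚ a p (constₚ 1ℚ) 0) (solve 1 (λ a → a :* con 1ℚ :+ con 0ℚ := a) refl a)
coeff-*ₚ-one (a ∷ p) (suc k) = trans (coeff-∷*ₚ a p (constₚ 1ℚ) (suc k))
  (trans (cong (a * 0ℚ +_) (coeff-*ₚ-one p k)) (solve 2 (λ a b → a :* con 0ℚ :+ b := b) refl a (coeff p k)))

-- Multiplying p·B by a linear factor a + b x on the right acts on the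
-- coefficient sequence of p·B (an instance of associativity and commutativity).
coeff-*ₚ-linear : ∀ a b p B k →
  coeff (p *ₚ ((a ∷ b ∷ []) *ₚ B)) k ≡ a * coeff (p *ₚ B) k + b * shift (coeff (p *ₚ B)) k
coeff-*ₚ-linear a b []      B zero    = solve 2 (λ a b → con 0ℚ := a :* con 0ℚ :+ b :* con 0ℚ) refl a b
coeff-*ₚ-linear a b []      B (suc k) = solve 2 (λ a b → con 0ℚ := a :* con 0ℚ :+ b :* con 0ℚ) refl a b
coeff-*ₚ-linear a b (c ∷ p) B k = begin
  coeff ((c ∷ p) *ₚ (L *ₚ B)) k
    ≡⟨ coeff-∷*ₚ c p (L *ₚ B) k ⟩
  c * coeff (L *ₚ B) k + shift (coeff (p *ₚ (L *ₚ B))) k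
    ≡⟨ cong₂ _+_ (cong (c *_) (coeff-linear*ₚ a b B k)) (shift-cong (coeff-*ₚ-linear a b p B) k) ⟩
  c * (a * β k + b * shift β k) + shift (λ i → a * π i + b * shift π i) k
    ≡⟨ cong (c * (a * β k + b * shift β k) +_) (shift-linear a b π (shift π) k) ⟩
  c * (a * β k + b * shift β k) + (a * shift π k + b * shift (shift π) k)
    ≡⟨ solve 7 (λ a b c β sβ sπ ssπ → c :* (a :* β :+ b :* sβ) :+ (a :* sπ :+ b :* ssπ)
                                   := a :* (c :* β :+ sπ) :+ b :* (c :* sβ :+ con 1ℚ :* ssπ))
               refl a b c (β k) (shift β k) (shift π k) (shift (shift π) k) ⟩
  a * (c * β k + shift π k) + b * (c * shift β k + 1ℚ * shift (shift π) k)
    ≡⟨ cong (a * (c * β k + shift π k) +_) (cong (b *_) (shift-linear c 1ℚ β (shift π) k)) ⟨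
  a * (c * β k + shift π k) + b * shift (λ i → c * β i + 1ℚ * shift π i) k
    ≡⟨ cong₂ (λ s t → a * s + b * t) (sym (coeff-∷*ₚ c p B k)) (shift-cong unit-shift k) ⟩
  a * coeff ((c ∷ p) *ₚ B) k + b * shift (coeff ((c ∷ p) *ₚ B)) k ∎
  where
  L = a ∷ b ∷ []
  β = coeff B
  π = coeff (p *ₚ B)
  unit-shift : ∀ i → c * β i + 1ℚ * shift π i ≡ coeff ((c ∷ p) *ₚ B) i
  unit-shift i = trans (cong (c * β i +_) (*-identityˡ (shift π i))) (sym (coeff-∷*ₚ c p B i))

coeff-*ₚ-[1+x]^ : ∀ p m → coeff (p *ₚ ((X +ₚ constₚ 1ℚ) ^ₚ m)) ≗ Tⁿ m (coeff p)
coeff-*ₚ-[1+x]^ p zero    k = coeff-*ₚ-one p k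
coeff-*ₚ-[1+x]^ p (suc m) k = begin
  coeff (p *ₚ ((X +ₚ constₚ 1ℚ) ^ₚ suc m)) k       ≡⟨ coeff-*ₚ-linear 1ℚ 1ℚ p ((X +ₚ constₚ 1ℚ) ^ₚ m) k ⟩
  1ℚ * π k + 1ℚ * shift π k                       ≡⟨ cong₂ _+_ (*-identityˡ (π k)) (*-identityˡ (shift π k)) ⟩
  T π k                                           ≡⟨ T-cong (coeff-*ₚ-[1+x]^ p m) k ⟩
  Tⁿ (suc m) (coeff p) k                          ∎
  where
  π = coeff (p *ₚ ((X +ₚ constₚ 1ℚ) ^ₚ m))

coeff-*ₚ-x^ : ∀ p m → VanishBelow m (coeff (p *ₚ (X ^ₚ m)))
coeff-*ₚ-x^ p zero    k ()
coeff-*ₚ-x^ p (suc m) k k<1+m = begin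
  coeff (p *ₚ (X ^ₚ suc m)) k       ≡⟨ coeff-*ₚ-linear 0ℚ 1ℚ p (X ^ₚ m) k ⟩
  0ℚ * π k + 1ℚ * shift π k         ≡⟨ solve 2 (λ a b → con 0ℚ :* a :+ con 1ℚ :* b := b) refl (π k) (shift π k) ⟩
  shift π k                         ≡⟨ shift-vanish (coeff-*ₚ-x^ p m) k k<1+m ⟩
  0ℚ                                ∎
  where
  π = coeff (p *ₚ (X ^ₚ m))

coeff-derivAux : ∀ i p k → coeff (derivAux i p) k ≡ ℕ→ℚ (i ℕ.+ k) * coeff p k
coeff-derivAux i []      k = sym (*-zeroʳ (ℕ→ℚ (i ℕ.+ k)))
coeff-derivAux i (a ∷ p) zero    rewrite ℕₚ.+-identityʳ i = refl
coeff-derivAux i (a ∷ p) (suc k) rewrite ℕₚ.+-suc i k     = coeff-derivAux (suc i) p k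

coeff-deriv : ∀ p → coeff (deriv p) ≗ ∂ (coeff p)
coeff-deriv []      k = sym (*-zeroʳ (ℕ→ℚ (suc k)))
coeff-deriv (a ∷ p) k = coeff-derivAux 1 p k

diffOp : ℕ → Poly → Poly
diffOp n Q = (X *ₚ (X +ₚ constₚ 1ℚ)) *ₚ deriv (deriv Q)
             +ₚ ((ℕ→ℚ 2 ·ₚ X) +ₚ constₚ (- ℕ→ℚ n)) *ₚ deriv Q
             +ₚ (- ℕ→ℚ (n ℕ.* suc n)) ·ₚ Q

coeff-x[x+1]Q'' : ∀ Q k → let q = coeff Q in
  coeff ((X *ₚ (X +ₚ constₚ 1ℚ)) *ₚ deriv (deriv Q)) k
    ≡ ℕ→ℚ k * (ℕ→ℚ (suc k) * q (suc k)) + (ℕ→ℚ k - 1ℚ) * ℕ→ℚ k * q k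
coeff-x[x+1]Q'' Q k = begin
  coeff ((0ℚ ∷ 1ℚ ∷ 1ℚ ∷ []) *ₚ deriv (deriv Q)) k
    ≡⟨ coeff-quadratic*ₚ 0ℚ 1ℚ 1ℚ (deriv (deriv Q)) k ⟩
  0ℚ * z k + (1ℚ * shift z k + 1ℚ * shift (shift z) k)
    ≡⟨ cong₂ (λ s t → 0ℚ * z k + (1ℚ * s + 1ℚ * t))
             (trans (shift-cong z≗∂²q k) (shift-∂ (∂ q) k))
             (trans (shift-cong (shift-cong z≗∂²q) k) (shift²-∂² q k)) ⟩
  0ℚ * z k + (1ℚ * (κ * ∂ q k) + 1ℚ * ((κ - 1ℚ) * κ * q k))
    ≡⟨ solve 3 (λ z s t → con 0ℚ :* z :+ (con 1ℚ :* s :+ con 1ℚ :* t) := s :+ t)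
               refl (z k) (κ * ∂ q k) ((κ - 1ℚ) * κ * q k) ⟩
  κ * ∂ q k + (κ - 1ℚ) * κ * q k ∎
  where
  q = coeff Q
  z = coeff (deriv (deriv Q))
  κ = ℕ→ℚ k
  z≗∂²q : z ≗ ∂ (∂ q)
  z≗∂²q i = trans (coeff-deriv (deriv Q) i) (cong (ℕ→ℚ (suc i) *_) (coeff-deriv Q (suc i)))

coeff-[2x-n]Q' : ∀ n Q k → let q = coeff Q in
  coeff (((ℕ→ℚ 2 ·ₚ X) +ₚ constₚ (- ℕ→ℚ n)) *ₚ deriv Q) k
    ≡ - ℕ→ℚ n * (ℕ→ℚ (suc k) * q (suc k)) + ℕ→ℚ 2 * (ℕ→ℚ k * q k)
coeff-[2x-n]Q' n Q k = begin
  coeff (((0ℚ + - ℕ→ℚ n) ∷ ℕ→ℚ 2 ∷ []) *ₚ deriv Q) k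
    ≡⟨ coeff-linear*ₚ (0ℚ + - ℕ→ℚ n) (ℕ→ℚ 2) (deriv Q) k ⟩
  (0ℚ + - ℕ→ℚ n) * coeff (deriv Q) k + ℕ→ℚ 2 * shift (coeff (deriv Q)) k
    ≡⟨ cong₂ (λ s t → s * coeff (deriv Q) k + ℕ→ℚ 2 * t)
             (+-identityˡ (- ℕ→ℚ n)) (trans (shift-cong (coeff-deriv Q) k) (shift-∂ q k)) ⟩
  - ℕ→ℚ n * coeff (deriv Q) k + ℕ→ℚ 2 * (ℕ→ℚ k * q k)
    ≡⟨ cong (λ s → - ℕ→ℚ n * s + ℕ→ℚ 2 * (ℕ→ℚ k * q k)) (coeff-deriv Q k) ⟩
  - ℕ→ℚ n * ∂ q k + ℕ→ℚ 2 * (ℕ→ℚ k * q k) ∎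
  where
  q = coeff Q

-- The polynomial identity  x(x+1)Q'' + (2x-n)Q' - n(n+1)Q = x R' - n R,
-- read at the k-th coefficient with a = q_k and b = q_(k+1).
euler-identity : ∀ n k a b →
  (ℕ→ℚ k * (ℕ→ℚ (suc k) * b) + (ℕ→ℚ k - 1ℚ) * ℕ→ℚ k * a)
    + (- ℕ→ℚ n * (ℕ→ℚ (suc k) * b) + ℕ→ℚ 2 * (ℕ→ℚ k * a))
    + (- ℕ→ℚ (n ℕ.* suc n)) * a
  ≡ (ℕ→ℚ k - ℕ→ℚ n) * ((ℕ→ℚ (suc k) * b + ℕ→ℚ k * a) + ℕ→ℚ (suc n) * a)
euler-identity n k a b rewrite ℕ→ℚ-* n (suc n) | ℕ→ℚ-suc k | ℕ→ℚ-suc n =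
  solve 4 (λ κ ν a b →
      (κ :* ((con 1ℚ :+ κ) :* b) :+ (κ :- con 1ℚ) :* κ :* a)
        :+ (:- ν :* ((con 1ℚ :+ κ) :* b) :+ (con 1ℚ :+ con 1ℚ) :* (κ :* a))
        :+ (:- (ν :* (con 1ℚ :+ ν))) :* a
    := (κ :- ν) :* (((con 1ℚ :+ κ) :* b :+ κ :* a) :+ (con 1ℚ :+ ν) :* a))
    refl (ℕ→ℚ k) (ℕ→ℚ n) a b

diffOp-coeff : ∀ n Q k → coeff (diffOp n Q) k ≡ (ℕ→ℚ k - ℕ→ℚ n) * R n (coeff Q) k
diffOp-coeff n Q k = begin
  coeff (L₁ +ₚ L₂ +ₚ L₃) k                    ≡⟨ coeff-+ₚ (L₁ +ₚ L₂) L₃ k ⟩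
  coeff (L₁ +ₚ L₂) k + coeff L₃ k             ≡⟨ cong (_+ coeff L₃ k) (coeff-+ₚ L₁ L₂ k) ⟩
  coeff L₁ k + coeff L₂ k + coeff L₃ k        ≡⟨ cong₂ _+_ (cong₂ _+_ (coeff-x[x+1]Q'' Q k) (coeff-[2x-n]Q' n Q k))
                                                            (coeff-·ₚ (- ℕ→ℚ (n ℕ.* suc n)) Q k) ⟩
  _                                           ≡⟨ euler-identity n k (coeff Q k) (coeff Q (suc k)) ⟩
  (ℕ→ℚ k - ℕ→ℚ n) * _                        ≡⟨ cong ((ℕ→ℚ k - ℕ→ℚ n) *_) (R-expand n (coeff Q) k) ⟨
  (ℕ→ℚ k - ℕ→ℚ n) * R n (coeff Q) k          ∎
  where
  L₁ = (X *ₚ (X +ₚ constₚ 1ℚ)) *ₚ deriv (deriv Q)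
  L₂ = ((ℕ→ℚ 2 ·ₚ X) +ₚ constₚ (- ℕ→ℚ n)) *ₚ deriv Q
  L₃ = (- ℕ→ℚ (n ℕ.* suc n)) ·ₚ Q

Bezout : ℕ → Poly → Poly → Set
Bezout n P Q = (P *ₚ (X ^ₚ suc n)) +ₚ (Q *ₚ ((X +ₚ constₚ 1ℚ) ^ₚ suc n)) ≈ₚ constₚ 1ℚ

bezout-middle-coeffs : ∀ n P Q → Bezout n P Q →
  VanishBelow n (λ j → Tⁿ (suc n) (coeff Q) (suc j))
bezout-middle-coeffs n P Q bezout j j<n = begin
  Tⁿ (suc n) (coeff Q) (suc j)                ≡⟨ coeff-*ₚ-[1+x]^ Q (suc n) (suc j) ⟨
  coeff QA (suc j)                            ≡⟨ +-identityˡ (coeff QA (suc j)) ⟨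
  0ℚ + coeff QA (suc j)                       ≡⟨ cong (_+ coeff QA (suc j)) (coeff-*ₚ-x^ P (suc n) (suc j) (s≤s j<n)) ⟨
  coeff PX (suc j) + coeff QA (suc j)         ≡⟨ coeff-+ₚ PX QA (suc j) ⟨
  coeff (PX +ₚ QA) (suc j)                    ≡⟨ bezout (suc j) ⟩
  0ℚ                                          ∎
  where
  PX = P *ₚ (X ^ₚ suc n)
  QA = Q *ₚ ((X +ₚ constₚ 1ℚ) ^ₚ suc n)

-- (1+x)^n R = (Q (1+x)^(n+1))' ≡ 0 modulo x^n, hence R ≡ 0 modulo x^n
R-vanish-below : ∀ n P Q → Bezout n P Q → VanishBelow n (R n (coeff Q))
R-vanish-below n P Q bezout = Tⁿ-cancel n n (R n (coeff Q)) λ j j<n → begin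
  Tⁿ n (R n (coeff Q)) j                               ≡⟨ ∂-Tⁿ n (coeff Q) j ⟨
  ℕ→ℚ (suc j) * Tⁿ (suc n) (coeff Q) (suc j)           ≡⟨ cong (ℕ→ℚ (suc j) *_) (bezout-middle-coeffs n P Q bezout j j<n) ⟩
  ℕ→ℚ (suc j) * 0ℚ                                     ≡⟨ *-zeroʳ (ℕ→ℚ (suc j)) ⟩
  0ℚ                                                   ∎

R-vanish-above : ∀ n Q → deg≤ Q n → ∀ k → n < k → R n (coeff Q) k ≡ 0ℚ
R-vanish-above n Q degQ k n<k = R-vanish-at n (coeff Q) k (degQ k n<k) (degQ (suc k) (<-trans n<k (n<1+n k)))

proposition2p8 : (n : ℕ) (P Q : Poly) →
    deg≤ P n → deg≤ Q n →
    (P *ₚ (X ^ₚ suc n)) +ₚ (Q *ₚ ((X +ₚ constₚ 1ℚ) ^ₚ suc n)) ≈ₚ constₚ 1ℚ →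
    (X *ₚ (X +ₚ constₚ 1ℚ)) *ₚ deriv (deriv Q)
      +ₚ ((ℕ→ℚ 2 ·ₚ X) +ₚ constₚ (- ℕ→ℚ n)) *ₚ deriv Q
      +ₚ (- ℕ→ℚ (n ℕ.* suc n)) ·ₚ Q
      ≈ₚ constₚ 0ℚ
proposition2p8 n P Q _ degQ bezout k = begin
  coeff (diffOp n Q) k                      ≡⟨ diffOp-coeff n Q k ⟩
  (ℕ→ℚ k - ℕ→ℚ n) * R n (coeff Q) k        ≡⟨ euler-kernel n (R n (coeff Q)) (R-vanish-below n P Q bezout)
                                                                (R-vanish-above n Q degQ) k ⟩
  0ℚ                                        ≡⟨ coeff-zero k ⟨
  coeff (constₚ 0ℚ) k                       ∎
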